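{- Let $N\equiv3\pmod 4$ be a positive integer, let $\omega=(1+\sqrt{ -N})/2$, and let $\Lambda\subset\mathbb{C}\cong\mathbb{R}^2$ be the lattice generated by $1$ and $\omega$ (so $\Lambda=\mathbb{Z}[\omega]$, a lattice with hexagonal Voronoi cell). For $\alpha=a+b\omega$ with $a,b\in\mathbb{Z}$, $\alpha\ne0$, the sublattice $\alpha\Lambda$ is clean if and only if all of the following hold: (i) $\alpha\theta$ is primitive, where $\theta=\omega-\bar\omega=\sqrt{ -N}$; (ii) there is an odd number $k$ dividing $N+1$ such that $\alpha(N-\theta)/(2k)$ is integral and primitive; (iii) there is an odd number $k$ dividing $N+1$ such that $\alpha(N+\theta)/(2k)$ is integral and primitive.
   Context: A sublattice $\Lambda'\subseteq\Lambda$ is clean if the boundaries of the Voronoi cells of $\Lambda'$ (in $\mathbb{R}^2$) contain no point of $\Lambda$. "Integral" means lying in $\mathbb{Z}[\omega]$; an element $r+s\omega\in\mathbb{Z}[\omega]$ ($r,s\in\mathbb{Z}$) is primitive if $\gcd(r,s)=1$. -}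

module Defs where

open import Data.Nat as ℕ using (ℕ; suc)
open import Data.Nat.Divisibility as ℕD using ()
open import Data.Integer as ℤ using (ℤ; +_; _+_; _-_; _*_; -_; _≤_)
open import Data.Integer.GCD using (gcd)
open import Data.Product using (_×_; _,_; Σ; ∃; proj₁; proj₂)
open import Relation.Binary.PropositionalEquality using (_≡_; _≢_)
open import Relation.Nullary using (¬_)

-- Parameter N : ℕ (with N ≡ 3 mod 4 assumed in the theorem).
-- ω = (1 + √-N)/2 satisfies ω² = ω - c with c = (N+1)/4 ∈ ℤ.
cN : ℕ → ℤ
cN N = + (suc N ℕ./ 4)

-- An element r + s ω of ℤ[ω] is represented by the pair (r , s).
Zω : Set
Zω = ℤ × ℤ

re im : Zω → ℤ
re = proj₁
im = proj₂

fromℤ : ℤ → Zω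
fromℤ n = (n , + 0)

ω : Zω
ω = (+ 0 , + 1)

_⊕_ : Zω → Zω → Zω
(a , b) ⊕ (c , d) = (a + c , b + d)

_⊖_ : Zω → Zω → Zω
(a , b) ⊖ (c , d) = (a - c , b - d)

-- multiplication in ℤ[ω], using ω² = ω - c
mul : ℕ → Zω → Zω → Zω
mul N (a , b) (c , d) = (a * c - b * d * cN N , a * d + b * c + b * d)

-- |a + bω|² = (a + bω)(a + bω̄) = a² + ab + c b²
normSq : ℕ → Zω → ℤ
normSq N (a , b) = a * a + a * b + cN N * b * b

-- θ = ω - ω̄ = 2ω - 1 = √-N
θ : Zω
θ = (ℤ.-[1+ 0 ] , + 2)

Primitive : Zω → Set
Primitive (r , s) = gcd r s ≡ + 1

IntegralPrimitiveQuot : ℕ → Zω → ℤ → Set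
IntegralPrimitiveQuot N x d = Σ Zω λ γ → mul N (fromℤ d) γ ≡ x × Primitive γ

Odd : ℕ → Set
Odd k = ∃ λ j → k ≡ suc (2 ℕ.* j)

InVoronoiCell : ℕ → Zω → Zω → Zω → Set
InVoronoiCell N α p x = ∀ (ρ : Zω) → normSq N (x ⊖ p) ≤ normSq N (x ⊖ mul N α ρ)

OnVoronoiBoundary : ℕ → Zω → Zω → Zω → Set
OnVoronoiBoundary N α p x =
  InVoronoiCell N α p x ×
  Σ Zω λ ν → (mul N α ν ≢ p) × (normSq N (x ⊖ p) ≡ normSq N (x ⊖ mul N α ν))

Clean : ℕ → Zω → Set
Clean N α = ∀ (x μ : Zω) → ¬ OnVoronoiBoundary N α (mul N α μ) x

-- Write c = (N + 1) / 4, so that ω² = ω - c and |a + bω|² = a² + ab + cb², and move the cell to 0.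
-- A point y of Λ on its boundary is equidistant from 0 and some α v ≠ 0; by the parallelogram law
-- v / 2 then lies in the Voronoi cell of Λ, which (as c ≥ 1) leaves the six neighbours ±1, ±ω,
-- ±(ω - 1) of 0: the edges of the hexagon.  If α v θ = k γ with γ primitive, the lattice points
-- on the bisector of 0 and α v are α v ω + j γ = α v (ω + (j / k) θ), so dividing by α the question
-- is whether v (ω + (j / k) θ) lies in the Voronoi cell of Λ.  For v = 1 this happens for some j
-- iff k > 1 (take j / k nearest to -1/2), so the 1-edges are free iff α θ is primitive.  The edges
-- towards ω and ω - 1 are shorter: they contain such a point when k is even (the midpoint) but
-- not when k is odd and at most (N + 1) / 2; and as v v̄ = c, k divides c · content(α θ) = c.
-- Finally α (N ∓ θ) = -2 α v θ for v = ω, ω - 1 turns the statement's conditions into these.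
-- Every inequality is proved by writing a difference of norms as an explicit sum of manifestly
-- nonnegative terms, the identity itself being checked by the ring solver.

module Submission where

open import Defs
open import Data.Nat.Base as ℕ using (ℕ; zero; suc; _%_; z≤n; s≤s)
import Data.Nat.Properties as ℕₚ
import Data.Nat.DivMod as ℕ
import Data.Nat.GCD as ℕ
open import Data.Nat.Divisibility using (_∣_; divides; ∣1⇒≡1)
open import Data.Integer.Base as ℤ
  using (ℤ; +_; -[1+_]; 0ℤ; 1ℤ; -1ℤ; _+_; _-_; _*_; -_; _≤_; _<_; +≤+; ∣_∣)
import Data.Integer.Properties as ℤₚ
open import Data.Integer.GCD using (gcd; gcd[i,j]∣i; gcd[i,j]∣j; gcd[i,j]≡0⇒i≡0; gcd[i,j]≡0⇒j≡0)
import Data.Integer.Divisibility.Signed as ℤ∣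
open import Data.Integer.Solver using (module +-*-Solver)
open import Data.Product using (_×_; _,_; ∃; ∃₂; proj₁; proj₂)
open import Data.Sum using (_⊎_; inj₁; inj₂; [_,_]′)
open import Function.Base using (_∘_; id; case_of_)
open import Function.Bundles using (_⇔_; mk⇔; Equivalence)
open import Relation.Nullary using (¬_; contradiction; yes; no)
open import Relation.Binary.PropositionalEquality

open +-*-Solver
open ≡-Reasoning

0≤+ : ∀ n → 0ℤ ≤ + n
0≤+ _ = +≤+ z≤n

0≤i+j : ∀ {i j} → 0ℤ ≤ i → 0ℤ ≤ j → 0ℤ ≤ i + j
0≤i+j = ℤₚ.+-mono-≤

0≤i*j : ∀ {i j} → 0ℤ ≤ i → 0ℤ ≤ j → 0ℤ ≤ i * j
0≤i*j {+ m} {+ n} _ _ = subst (0ℤ ≤_) (ℤₚ.pos-* m n) (0≤+ (m ℕ.* n))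

0≤i*i : ∀ i → 0ℤ ≤ i * i
0≤i*i (+ n)    = 0≤i*j {+ n} {+ n} (0≤+ n) (0≤+ n)
0≤i*i -[1+ n ] = 0≤+ _

0≤i*[i+1] : ∀ i → 0ℤ ≤ i * (i + 1ℤ)
0≤i*[i+1] (+ n)        = 0≤i*j {+ n} {+ n + 1ℤ} (0≤+ n) (0≤+ _)
0≤i*[i+1] -[1+ zero ]  = 0≤+ 0
0≤i*[i+1] -[1+ suc n ] = 0≤+ _

1≤i*i : ∀ {i} → i ≢ 0ℤ → 1ℤ ≤ i * i
1≤i*i {+ zero}    i≢0 = contradiction refl i≢0
1≤i*i {+ suc n}   _   = +≤+ (s≤s z≤n)
1≤i*i { -[1+ n ]} _   = +≤+ (s≤s z≤n)

0<i*i : ∀ {i} → i ≢ 0ℤ → 0ℤ < i * i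
0<i*i i≢0 = ℤₚ.suc[i]≤j⇒i<j (1≤i*i i≢0)

0≤⊎0≤-i-1 : ∀ i → 0ℤ ≤ i ⊎ 0ℤ ≤ - i - 1ℤ
0≤⊎0≤-i-1 (+ n)    = inj₁ (0≤+ n)
0≤⊎0≤-i-1 -[1+ n ] = inj₂ (0≤+ n)

≤-by : ∀ {i j} d → 0ℤ ≤ d → i + d ≡ j → i ≤ j
≤-by {i} d 0≤d refl = ℤₚ.i≤i+j i d {{ℤ.nonNegative 0≤d}}

<-by : ∀ {i j} d → 0ℤ ≤ d → 1ℤ + i + d ≡ j → i < j
<-by d 0≤d eq = ℤₚ.suc[i]≤j⇒i<j (≤-by d 0≤d eq)

drop-zero : ∀ {x a e} k → x ≡ a + k * e → e ≡ 0ℤ → x ≡ a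
drop-zero {a = a} k eq refl = trans eq (trans (cong (λ t → a + t) (ℤₚ.*-zeroʳ k)) (ℤₚ.+-identityʳ a))

scaled-≤ : ∀ {m n x y x′ y′} → 0ℤ < m → 0ℤ < n → m * x ≡ n * x′ → m * y ≡ n * y′ → x ≤ y → x′ ≤ y′
scaled-≤ {m} {n} {x′ = x′} {y′} 0<m 0<n mx≡nx′ my≡ny′ x≤y =
  ℤₚ.*-cancelˡ-≤-pos x′ y′ n {{ℤ.positive 0<n}}
    (subst₂ _≤_ mx≡nx′ my≡ny′ (ℤₚ.*-monoˡ-≤-nonNeg m {{ℤ.nonNegative (ℤₚ.<⇒≤ 0<m)}} x≤y))

scaled-≡ : ∀ {n x y x′ y′} m → n ≢ 0ℤ → m * x ≡ n * x′ → m * y ≡ n * y′ → x ≡ y → x′ ≡ y′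
scaled-≡ {n} {x′ = x′} {y′} m n≢0 mx≡nx′ my≡ny′ refl =
  ℤₚ.*-cancelˡ-≡ n x′ y′ {{ℤ.≢-nonZero n≢0}} (trans (sym mx≡nx′) my≡ny′)

parity : ∀ n → (∃ λ h → n ≡ 2 ℕ.* h) ⊎ (∃ λ h → n ≡ suc (2 ℕ.* h))
parity zero = inj₁ (0 , refl)
parity (suc n) with parity n
... | inj₁ (h , refl) = inj₂ (h , refl)
... | inj₂ (h , refl) = inj₁ (suc h , cong suc (sym (ℕₚ.+-suc h (h ℕ.+ 0))))

odd-ℤ : ∀ h → + suc (2 ℕ.* h) ≡ 1ℤ + + 2 * + h
odd-ℤ h = cong (λ t → 1ℤ + t) (ℤₚ.pos-* 2 h)

infixr 26 _∙_
_∙_ : ℤ → Zω → Zω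
k ∙ (a , b) = (k * a , k * b)

infix 27 ⊝_
⊝_ : Zω → Zω
⊝ (a , b) = (- a , - b)

0ω 1ω ω-1 : Zω
0ω  = (0ℤ , 0ℤ)
1ω  = (1ℤ , 0ℤ)
ω-1 = ω ⊖ 1ω

det : Zω → Zω → ℤ
det (a , b) (p , q) = a * q - b * p

∙-identityˡ : ∀ x → 1ℤ ∙ x ≡ x
∙-identityˡ (a , b) = cong₂ _,_ (ℤₚ.*-identityˡ a) (ℤₚ.*-identityˡ b)

∙-∙ : ∀ h k x → h ∙ (k ∙ x) ≡ (k * h) ∙ x
∙-∙ h k (a , b) = cong₂ _,_ (solve 3 (λ h k a → h :* (k :* a) := k :* h :* a) refl h k a)
                            (solve 3 (λ h k b → h :* (k :* b) := k :* h :* b) refl h k b)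

∙-cancel : ∀ k {x y} → k ≢ 0ℤ → k ∙ x ≡ k ∙ y → x ≡ y
∙-cancel k {a , b} {p , q} k≢0 eq =
  cong₂ _,_ (ℤₚ.*-cancelˡ-≡ k a p {{ℤ.≢-nonZero k≢0}} (cong proj₁ eq))
            (ℤₚ.*-cancelˡ-≡ k b q {{ℤ.≢-nonZero k≢0}} (cong proj₂ eq))

⊝-involutive : ∀ x → ⊝ ⊝ x ≡ x
⊝-involutive (a , b) = cong₂ _,_ (ℤₚ.neg-involutive a) (ℤₚ.neg-involutive b)

⊝-injective : ∀ {x y} → ⊝ x ≡ ⊝ y → x ≡ y
⊝-injective {x} {y} eq = trans (sym (⊝-involutive x)) (trans (cong ⊝_ eq) (⊝-involutive y))

⊖≡0⇒≡ : ∀ x y → x ⊖ y ≡ 0ω → x ≡ y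
⊖≡0⇒≡ (a , b) (p , q) eq =
  cong₂ _,_ (ℤₚ.i-j≡0⇒i≡j a p (cong proj₁ eq)) (ℤₚ.i-j≡0⇒i≡j b q (cong proj₂ eq))

det-∙ʳ : ∀ x k y → det x (k ∙ y) ≡ k * det x y
det-∙ʳ (a , b) k (p , q) =
  solve 5 (λ a b k p q → a :* (k :* q) :- b :* (k :* p) := k :* (a :* q :- b :* p)) refl a b k p q

-- Primitive vectors

sign-factor : ∀ r → ∃ λ e → + (∣ r ∣) ≡ e * r
sign-factor (+ n)    = 1ℤ , sym (ℤₚ.*-identityˡ (+ n))
sign-factor -[1+ n ] = -1ℤ , sym (ℤₚ.-1*i≡-i -[1+ n ])

cast-bézout-identity : ∀ {d} x m y n → d ℕ.+ y ℕ.* n ≡ x ℕ.* m → + x * + m - + y * + n ≡ + d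
cast-bézout-identity {d} x m y n eq = begin
  + x * + m - + y * + n           ≡⟨ cong₂ _-_ (ℤₚ.pos-* x m) (ℤₚ.pos-* y n) ⟨
  + (x ℕ.* m) - + (y ℕ.* n)       ≡⟨ cong (λ t → + t - + (y ℕ.* n)) eq ⟨
  + d + + (y ℕ.* n) - + (y ℕ.* n) ≡⟨ solve 2 (λ d t → d :+ t :- t := d) refl (+ d) (+ (y ℕ.* n)) ⟩
  + d                             ∎

bézout : ∀ r s → ∃₂ λ u v → u * r + v * s ≡ gcd r s
bézout r s with ℕ.Bézout.identity (ℕ.gcd-GCD (∣ r ∣) (∣ s ∣)) | sign-factor r | sign-factor s
... | ℕ.Bézout.+- x y eq | er , ∣r∣≡ | es , ∣s∣≡ = + x * er , - (+ y * es) , (begin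
  + x * er * r + - (+ y * es) * s   ≡⟨ solve 6 (λ x y er es r s →
                                          x :* er :* r :+ :- (y :* es) :* s := x :* (er :* r) :- y :* (es :* s))
                                          refl (+ x) (+ y) er es r s ⟩
  + x * (er * r) - + y * (es * s)   ≡⟨ cong₂ (λ a b → + x * a - + y * b) ∣r∣≡ ∣s∣≡ ⟨
  + x * + (∣ r ∣) - + y * + (∣ s ∣) ≡⟨ cast-bézout-identity x (∣ r ∣) y (∣ s ∣) eq ⟩
  gcd r s                           ∎)
... | ℕ.Bézout.-+ x y eq | er , ∣r∣≡ | es , ∣s∣≡ = - (+ x * er) , + y * es , (begin
  - (+ x * er) * r + + y * es * s   ≡⟨ solve 6 (λ x y er es r s →
                                          :- (x :* er) :* r :+ y :* es :* s := y :* (es :* s) :- x :* (er :* r))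
                                          refl (+ x) (+ y) er es r s ⟩
  + y * (es * s) - + x * (er * r)   ≡⟨ cong₂ (λ a b → + y * b - + x * a) ∣r∣≡ ∣s∣≡ ⟨
  + y * + (∣ s ∣) - + x * + (∣ r ∣) ≡⟨ cast-bézout-identity y (∣ s ∣) x (∣ r ∣) eq ⟩
  gcd r s                           ∎)

bézout⇒primitive : ∀ {r s} u v → u * r + v * s ≡ 1ℤ → Primitive (r , s)
bézout⇒primitive {r} {s} u v eq = cong +_ (∣1⇒≡1 (ℤ∣.∣⇒∣ᵤ (subst (gcd r s ℤ∣.∣_) eq
  (ℤ∣.∣m∣n⇒∣m+n (ℤ∣.∣n⇒∣m*n u (ℤ∣.∣ᵤ⇒∣ (gcd[i,j]∣i r s)))
                (ℤ∣.∣n⇒∣m*n v (ℤ∣.∣ᵤ⇒∣ (gcd[i,j]∣j r s)))))))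

primitive⇒bézout : ∀ {r s} → Primitive (r , s) → ∃₂ λ u v → u * r + v * s ≡ 1ℤ
primitive⇒bézout {r} {s} prim with bézout r s
... | u , v , eq = u , v , trans eq prim

primitive-⊝ : ∀ γ → Primitive γ → Primitive (⊝ γ)
primitive-⊝ (a , b) = trans (cong₂ (λ m n → + ℕ.gcd m n) (ℤₚ.∣-i∣≡∣i∣ a) (ℤₚ.∣-i∣≡∣i∣ b))

content : ∀ x → x ≢ 0ω → ∃₂ λ g γ → x ≡ (+ suc g) ∙ γ × Primitive γ
content (r , s) x≢0 with ℤ∣.∣ᵤ⇒∣ (gcd[i,j]∣i r s) | ℤ∣.∣ᵤ⇒∣ (gcd[i,j]∣j r s) | bézout r s
... | ℤ∣.divides qr r≡ | ℤ∣.divides qs s≡ | u , v , bez = split (ℕ.gcd (∣ r ∣) (∣ s ∣)) refl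
  where
  split : ∀ d → gcd r s ≡ + d → ∃₂ λ g γ → (r , s) ≡ (+ suc g) ∙ γ × Primitive γ
  split zero    g≡0 = contradiction (cong₂ _,_ (gcd[i,j]≡0⇒i≡0 r s g≡0) (gcd[i,j]≡0⇒j≡0 {r} g≡0)) x≢0
  split (suc g) g≡  = g , (qr , qs) , cong₂ _,_ r≡g*qr s≡g*qs , bézout⇒primitive u v unit
    where
    r≡g*qr : r ≡ + suc g * qr
    r≡g*qr = trans r≡ (trans (cong (qr *_) g≡) (ℤₚ.*-comm qr _))
    s≡g*qs : s ≡ + suc g * qs
    s≡g*qs = trans s≡ (trans (cong (qs *_) g≡) (ℤₚ.*-comm qs _))
    unit : u * qr + v * qs ≡ 1ℤ
    unit = ℤₚ.*-cancelˡ-≡ (+ suc g) _ _ (begin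
      + suc g * (u * qr + v * qs)             ≡⟨ solve 5 (λ g u v qr qs →
                                                    g :* (u :* qr :+ v :* qs) := u :* (g :* qr) :+ v :* (g :* qs))
                                                    refl (+ suc g) u v qr qs ⟩
      u * (+ suc g * qr) + v * (+ suc g * qs) ≡⟨ cong₂ (λ a b → u * a + v * b) r≡g*qr s≡g*qs ⟨
      u * r + v * s                           ≡⟨ trans bez g≡ ⟩
      + suc g                                 ≡⟨ ℤₚ.*-identityʳ _ ⟨
      + suc g * 1ℤ                            ∎)

det≡0⇒multiple : ∀ p γ → Primitive γ → det p γ ≡ 0ℤ → ∃ λ j → p ≡ j ∙ γ
det≡0⇒multiple (p₁ , p₂) (γ₁ , γ₂) prim det≡0 with primitive⇒bézout prim
... | u , v , bez = u * p₁ + v * p₂ , cong₂ _,_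
  (drop-zero v (begin
    p₁                     ≡⟨ ℤₚ.*-identityʳ p₁ ⟨
    p₁ * 1ℤ                ≡⟨ cong (p₁ *_) bez ⟨
    p₁ * (u * γ₁ + v * γ₂) ≡⟨ solve 6 (λ p₁ p₂ γ₁ γ₂ u v →
                                   p₁ :* (u :* γ₁ :+ v :* γ₂)
                                := (u :* p₁ :+ v :* p₂) :* γ₁ :+ v :* (p₁ :* γ₂ :- p₂ :* γ₁))
                                   refl p₁ p₂ γ₁ γ₂ u v ⟩
    (u * p₁ + v * p₂) * γ₁ + v * det (p₁ , p₂) (γ₁ , γ₂) ∎) det≡0)
  (drop-zero (- u) (begin
    p₂                     ≡⟨ ℤₚ.*-identityʳ p₂ ⟨
    p₂ * 1ℤ                ≡⟨ cong (p₂ *_) bez ⟨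
    p₂ * (u * γ₁ + v * γ₂) ≡⟨ solve 6 (λ p₁ p₂ γ₁ γ₂ u v →
                                   p₂ :* (u :* γ₁ :+ v :* γ₂)
                                := (u :* p₁ :+ v :* p₂) :* γ₂ :+ :- u :* (p₁ :* γ₂ :- p₂ :* γ₁))
                                   refl p₁ p₂ γ₁ γ₂ u v ⟩
    (u * p₁ + v * p₂) * γ₂ + - u * det (p₁ , p₂) (γ₁ , γ₂) ∎) det≡0)

primitive-divisor : ∀ x y k a → Primitive x → k ∙ y ≡ a ∙ x → ∃ λ t → a ≡ k * t
primitive-divisor (x₁ , x₂) (y₁ , y₂) k a prim eq with primitive⇒bézout prim
... | u , v , bez = u * y₁ + v * y₂ , (begin
  a                           ≡⟨ ℤₚ.*-identityʳ a ⟨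
  a * 1ℤ                      ≡⟨ cong (a *_) bez ⟨
  a * (u * x₁ + v * x₂)       ≡⟨ solve 5 (λ a u v x₁ x₂ →
                                   a :* (u :* x₁ :+ v :* x₂) := u :* (a :* x₁) :+ v :* (a :* x₂))
                                   refl a u v x₁ x₂ ⟩
  u * (a * x₁) + v * (a * x₂) ≡⟨ cong₂ (λ s t → u * s + v * t) (cong proj₁ eq) (cong proj₂ eq) ⟨
  u * (k * y₁) + v * (k * y₂) ≡⟨ solve 5 (λ k u v y₁ y₂ →
                                   u :* (k :* y₁) :+ v :* (k :* y₂) := k :* (u :* y₁ :+ v :* y₂))
                                   refl k u v y₁ y₂ ⟩
  k * (u * y₁ + v * y₂)       ∎)

data Direction : Zω → Set where
  dir-1   : Direction 1ω
  dir-ω   : Direction ω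
  dir-ω-1 : Direction ω-1

-- Copies of the operations of Defs on solver syntax, with c a variable: an identity between
-- expressions built from mul, normSq, ... is proved by `solve` on the mirrored expression.

module Mirror {n : ℕ} (c : Polynomial n) where

  Pω : Set
  Pω = Polynomial n × Polynomial n

  infixl 25 _:·_
  infixr 26 _:∙_
  infix 27 :⊝_
  infix 4 _:=₁_ _:=₂_

  :‖_‖ : Pω → Polynomial n
  :‖ (a , b) ‖ = a :* a :+ a :* b :+ c :* b :* b

  _:·_ _:⊕_ _:⊖_ : Pω → Pω → Pω
  (a , b) :· (p , q) = (a :* p :- b :* q :* c , a :* q :+ b :* p :+ b :* q)
  (a , b) :⊕ (p , q) = (a :+ p , b :+ q)
  (a , b) :⊖ (p , q) = (a :- p , b :- q)

  _:∙_ : Polynomial n → Pω → Pω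
  k :∙ (a , b) = (k :* a , k :* b)

  :⊝_ : Pω → Pω
  :⊝ (a , b) = (:- a , :- b)

  :det : Pω → Pω → Polynomial n
  :det (a , b) (p , q) = a :* q :- b :* p

  :fromℤ : Polynomial n → Pω
  :fromℤ k = (k , con 0ℤ)

  :ω :θ :1ω :0ω : Pω
  :ω  = (con 0ℤ , con 1ℤ)
  :θ  = (con -1ℤ , con (+ 2))
  :1ω = (con 1ℤ , con 0ℤ)
  :0ω = (con 0ℤ , con 0ℤ)

  _:=₁_ _:=₂_ : Pω → Pω → Polynomial n × Polynomial n
  (a , b) :=₁ (p , q) = a := p
  (a , b) :=₂ (p , q) = b := q

module Lattice (N : ℕ) where

  c : ℤ
  c = cN N

  -- Defs' _⊕_ and _⊖_ have the default precedence 20, below that of _·_ and _∙_.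
  infixl 25 _·_
  _·_ : Zω → Zω → Zω
  _·_ = mul N

  ‖_‖ : Zω → ℤ
  ‖_‖ = normSq N

  ·-assoc : ∀ x y z → x · y · z ≡ x · (y · z)
  ·-assoc (a , b) (p , q) (r , s) = cong₂ _,_
    (solve 7 (λ c a b p q r s → let open Mirror c in
      (a , b) :· (p , q) :· (r , s) :=₁ (a , b) :· ((p , q) :· (r , s))) refl c a b p q r s)
    (solve 7 (λ c a b p q r s → let open Mirror c in
      (a , b) :· (p , q) :· (r , s) :=₂ (a , b) :· ((p , q) :· (r , s))) refl c a b p q r s)

  ·-identityʳ : ∀ x → x · 1ω ≡ x
  ·-identityʳ (a , b) = cong₂ _,_
    (solve 3 (λ c a b → let open Mirror c in (a , b) :· :1ω :=₁ (a , b)) refl c a b)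
    (solve 3 (λ c a b → let open Mirror c in (a , b) :· :1ω :=₂ (a , b)) refl c a b)

  ·-zeroʳ : ∀ x → x · 0ω ≡ 0ω
  ·-zeroʳ (a , b) = cong₂ _,_
    (solve 3 (λ c a b → let open Mirror c in (a , b) :· :0ω :=₁ :0ω) refl c a b)
    (solve 3 (λ c a b → let open Mirror c in (a , b) :· :0ω :=₂ :0ω) refl c a b)

  ⊖-identityʳ : ∀ x → x ⊖ 0ω ≡ x
  ⊖-identityʳ (a , b) = cong₂ _,_ (ℤₚ.+-identityʳ a) (ℤₚ.+-identityʳ b)

  ⊖-⊕-cancel : ∀ x y → (x ⊖ y) ⊕ y ≡ x
  ⊖-⊕-cancel (a , b) (p , q) = cong₂ _,_
    (solve 2 (λ a p → a :- p :+ p := a) refl a p) (solve 2 (λ b q → b :- q :+ q := b) refl b q)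

  ⊕-⊖-cancel : ∀ x y → x ⊕ (y ⊖ x) ≡ y
  ⊕-⊖-cancel (a , b) (p , q) = cong₂ _,_
    (solve 2 (λ a p → a :+ (p :- a) := p) refl a p) (solve 2 (λ b q → b :+ (q :- b) := q) refl b q)

  ⊖-·-⊕ : ∀ x α p μ → x ⊖ α · (p ⊕ μ) ≡ (x ⊖ α · μ) ⊖ α · p
  ⊖-·-⊕ (x₁ , x₂) (a , b) (p₁ , p₂) (μ₁ , μ₂) = cong₂ _,_
    (solve 9 (λ c x₁ x₂ a b p₁ p₂ μ₁ μ₂ → let open Mirror c
                                              x = (x₁ , x₂); α = (a , b); p = (p₁ , p₂); μ = (μ₁ , μ₂)
                                          in x :⊖ α :· (p :⊕ μ) :=₁ (x :⊖ α :· μ) :⊖ α :· p)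
      refl c x₁ x₂ a b p₁ p₂ μ₁ μ₂)
    (solve 9 (λ c x₁ x₂ a b p₁ p₂ μ₁ μ₂ → let open Mirror c
                                              x = (x₁ , x₂); α = (a , b); p = (p₁ , p₂); μ = (μ₁ , μ₂)
                                          in x :⊖ α :· (p :⊕ μ) :=₂ (x :⊖ α :· μ) :⊖ α :· p)
      refl c x₁ x₂ a b p₁ p₂ μ₁ μ₂)

  ·-distribˡ-⊖ : ∀ α x y → α · (x ⊖ y) ≡ α · x ⊖ α · y
  ·-distribˡ-⊖ (a , b) (x₁ , x₂) (y₁ , y₂) = cong₂ _,_
    (solve 7 (λ c a b x₁ x₂ y₁ y₂ → let open Mirror c; α = (a , b); x = (x₁ , x₂); y = (y₁ , y₂)
                                    in α :· (x :⊖ y) :=₁ α :· x :⊖ α :· y) refl c a b x₁ x₂ y₁ y₂)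
    (solve 7 (λ c a b x₁ x₂ y₁ y₂ → let open Mirror c; α = (a , b); x = (x₁ , x₂); y = (y₁ , y₂)
                                    in α :· (x :⊖ y) :=₂ α :· x :⊖ α :· y) refl c a b x₁ x₂ y₁ y₂)

  ∙-⊖-· : ∀ D y α p → D ∙ (y ⊖ α · p) ≡ D ∙ y ⊖ α · (fromℤ D · p)
  ∙-⊖-· D (y₁ , y₂) (a , b) (p₁ , p₂) = cong₂ _,_
    (solve 8 (λ c D y₁ y₂ a b p₁ p₂ → let open Mirror c; y = (y₁ , y₂); α = (a , b); p = (p₁ , p₂)
                                      in D :∙ (y :⊖ α :· p) :=₁ D :∙ y :⊖ α :· (:fromℤ D :· p))
      refl c D y₁ y₂ a b p₁ p₂)
    (solve 8 (λ c D y₁ y₂ a b p₁ p₂ → let open Mirror c; y = (y₁ , y₂); α = (a , b); p = (p₁ , p₂)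
                                      in D :∙ (y :⊖ α :· p) :=₂ D :∙ y :⊖ α :· (:fromℤ D :· p))
      refl c D y₁ y₂ a b p₁ p₂)

  ∙-·ˡ : ∀ k x y → k ∙ (x · y) ≡ (k ∙ x) · y
  ∙-·ˡ k (a , b) (p , q) = cong₂ _,_
    (solve 6 (λ c k a b p q → let open Mirror c in
      k :∙ ((a , b) :· (p , q)) :=₁ (k :∙ (a , b)) :· (p , q)) refl c k a b p q)
    (solve 6 (λ c k a b p q → let open Mirror c in
      k :∙ ((a , b) :· (p , q)) :=₂ (k :∙ (a , b)) :· (p , q)) refl c k a b p q)

  ∙-distrib-⊕ : ∀ k w j γ → k ∙ (w · ω ⊕ j ∙ γ) ≡ w · (k ∙ ω) ⊕ j ∙ (k ∙ γ)
  ∙-distrib-⊕ k (w₁ , w₂) j (γ₁ , γ₂) = cong₂ _,_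
    (solve 7 (λ c k w₁ w₂ j γ₁ γ₂ → let open Mirror c; w = (w₁ , w₂); γ = (γ₁ , γ₂)
                                    in k :∙ (w :· :ω :⊕ j :∙ γ) :=₁ w :· (k :∙ :ω) :⊕ j :∙ (k :∙ γ))
      refl c k w₁ w₂ j γ₁ γ₂)
    (solve 7 (λ c k w₁ w₂ j γ₁ γ₂ → let open Mirror c; w = (w₁ , w₂); γ = (γ₁ , γ₂)
                                    in k :∙ (w :· :ω :⊕ j :∙ γ) :=₂ w :· (k :∙ :ω) :⊕ j :∙ (k :∙ γ))
      refl c k w₁ w₂ j γ₁ γ₂)

  ·-distribˡ-⊕-∙ : ∀ w k j → w · (k ∙ ω) ⊕ j ∙ (w · θ) ≡ w · (k ∙ ω ⊕ j ∙ θ)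
  ·-distribˡ-⊕-∙ (w₁ , w₂) k j = cong₂ _,_
    (solve 5 (λ c w₁ w₂ k j → let open Mirror c; w = (w₁ , w₂)
                              in w :· (k :∙ :ω) :⊕ j :∙ (w :· :θ) :=₁ w :· (k :∙ :ω :⊕ j :∙ :θ))
      refl c w₁ w₂ k j)
    (solve 5 (λ c w₁ w₂ k j → let open Mirror c; w = (w₁ , w₂)
                              in w :· (k :∙ :ω) :⊕ j :∙ (w :· :θ) :=₂ w :· (k :∙ :ω :⊕ j :∙ :θ))
      refl c w₁ w₂ k j)

  ·-midpoint : ∀ w h → w · ((+ 2 * h) ∙ ω ⊕ (- h) ∙ θ) ≡ h ∙ w
  ·-midpoint (w₁ , w₂) h = cong₂ _,_
    (solve 4 (λ c w₁ w₂ h → let open Mirror c; w = (w₁ , w₂)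
                            in w :· ((con (+ 2) :* h) :∙ :ω :⊕ (:- h) :∙ :θ) :=₁ h :∙ w) refl c w₁ w₂ h)
    (solve 4 (λ c w₁ w₂ h → let open Mirror c; w = (w₁ , w₂)
                            in w :· ((con (+ 2) :* h) :∙ :ω :⊕ (:- h) :∙ :θ) :=₂ h :∙ w) refl c w₁ w₂ h)

  unit-edge-content : ∀ x → 1ℤ ∙ (x · θ) ≡ x · 1ω · θ
  unit-edge-content (a , b) = cong₂ _,_
    (solve 3 (λ c a b → let open Mirror c in con 1ℤ :∙ ((a , b) :· :θ) :=₁ (a , b) :· :1ω :· :θ) refl c a b)
    (solve 3 (λ c a b → let open Mirror c in con 1ℤ :∙ ((a , b) :· :θ) :=₂ (a , b) :· :1ω :· :θ) refl c a b)

  ω·[1-ω]≡c : ∀ α → α · ω · θ · (1ω ⊖ ω) ≡ c ∙ (α · θ)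
  ω·[1-ω]≡c (a , b) = cong₂ _,_
    (solve 3 (λ c a b → let open Mirror c in
      (a , b) :· :ω :· :θ :· (:1ω :⊖ :ω) :=₁ c :∙ ((a , b) :· :θ)) refl c a b)
    (solve 3 (λ c a b → let open Mirror c in
      (a , b) :· :ω :· :θ :· (:1ω :⊖ :ω) :=₂ c :∙ ((a , b) :· :θ)) refl c a b)

  [ω-1]·-ω≡c : ∀ α → α · ω-1 · θ · (⊝ ω) ≡ c ∙ (α · θ)
  [ω-1]·-ω≡c (a , b) = cong₂ _,_
    (solve 3 (λ c a b → let open Mirror c in
      (a , b) :· (:ω :⊖ :1ω) :· :θ :· :⊝ :ω :=₁ c :∙ ((a , b) :· :θ)) refl c a b)
    (solve 3 (λ c a b → let open Mirror c in
      (a , b) :· (:ω :⊖ :1ω) :· :θ :· :⊝ :ω :=₂ c :∙ ((a , b) :· :θ)) refl c a b)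

  [4c-1]-θ≡-2ωθ : ∀ α → α · (fromℤ (+ 4 * c - 1ℤ) ⊖ θ) ≡ ⊝ ((+ 2) ∙ (α · ω · θ))
  [4c-1]-θ≡-2ωθ (a , b) = cong₂ _,_
    (solve 3 (λ c a b → let open Mirror c in
      (a , b) :· (:fromℤ (con (+ 4) :* c :- con 1ℤ) :⊖ :θ) :=₁ :⊝ (con (+ 2) :∙ ((a , b) :· :ω :· :θ)))
      refl c a b)
    (solve 3 (λ c a b → let open Mirror c in
      (a , b) :· (:fromℤ (con (+ 4) :* c :- con 1ℤ) :⊖ :θ) :=₂ :⊝ (con (+ 2) :∙ ((a , b) :· :ω :· :θ)))
      refl c a b)

  [4c-1]+θ≡-2[ω-1]θ : ∀ α → α · (fromℤ (+ 4 * c - 1ℤ) ⊕ θ) ≡ ⊝ ((+ 2) ∙ (α · ω-1 · θ))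
  [4c-1]+θ≡-2[ω-1]θ (a , b) = cong₂ _,_
    (solve 3 (λ c a b → let open Mirror c in
      (a , b) :· (:fromℤ (con (+ 4) :* c :- con 1ℤ) :⊕ :θ) :=₁ :⊝ (con (+ 2) :∙ ((a , b) :· (:ω :⊖ :1ω) :· :θ)))
      refl c a b)
    (solve 3 (λ c a b → let open Mirror c in
      (a , b) :· (:fromℤ (con (+ 4) :* c :- con 1ℤ) :⊕ :θ) :=₂ :⊝ (con (+ 2) :∙ ((a , b) :· (:ω :⊖ :1ω) :· :θ)))
      refl c a b)

  2k-quotient : ∀ k γ → fromℤ (+ 2 * k) · γ ≡ ⊝ ((+ 2) ∙ (k ∙ ⊝ γ))
  2k-quotient k (γ₁ , γ₂) = cong₂ _,_
    (solve 4 (λ c k γ₁ γ₂ → let open Mirror c in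
      :fromℤ (con (+ 2) :* k) :· (γ₁ , γ₂) :=₁ :⊝ (con (+ 2) :∙ (k :∙ :⊝ (γ₁ , γ₂)))) refl c k γ₁ γ₂)
    (solve 4 (λ c k γ₁ γ₂ → let open Mirror c in
      :fromℤ (con (+ 2) :* k) :· (γ₁ , γ₂) :=₂ :⊝ (con (+ 2) :∙ (k :∙ :⊝ (γ₁ , γ₂)))) refl c k γ₁ γ₂)

  norm-· : ∀ x y → ‖ x · y ‖ ≡ ‖ x ‖ * ‖ y ‖
  norm-· (a , b) (p , q) = solve 5 (λ c a b p q → let open Mirror c in
    :‖ (a , b) :· (p , q) ‖ := :‖ (a , b) ‖ :* :‖ (p , q) ‖) refl c a b p q

  norm-∙ : ∀ k x → ‖ k ∙ x ‖ ≡ k * k * ‖ x ‖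
  norm-∙ k (a , b) = solve 4 (λ c k a b → let open Mirror c in
    :‖ k :∙ (a , b) ‖ := k :* k :* :‖ (a , b) ‖) refl c k a b

  norm-⊝ : ∀ y → ‖ ⊝ y ‖ ≡ ‖ y ‖
  norm-⊝ (a , b) = solve 3 (λ c a b → let open Mirror c in :‖ :⊝ (a , b) ‖ := :‖ (a , b) ‖) refl c a b

  norm-⊝-⊖ : ∀ y α p → ‖ ⊝ y ⊖ α · p ‖ ≡ ‖ y ⊖ α · ⊝ p ‖
  norm-⊝-⊖ (y₁ , y₂) (a , b) (p₁ , p₂) =
    solve 7 (λ c y₁ y₂ a b p₁ p₂ → let open Mirror c; y = (y₁ , y₂); α = (a , b); p = (p₁ , p₂)
                                   in :‖ :⊝ y :⊖ α :· p ‖ := :‖ y :⊖ α :· :⊝ p ‖) refl c y₁ y₂ a b p₁ p₂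

  norm-0ω : ‖ 0ω ‖ ≡ 0ℤ
  norm-0ω = solve 1 (λ c → let open Mirror c in :‖ :0ω ‖ := con 0ℤ) refl c

  norm-⊖-2·self : ∀ v → ‖ v ‖ ≡ ‖ v ⊖ fromℤ (+ 2) · v ‖
  norm-⊖-2·self (v₁ , v₂) = solve 3 (λ c v₁ v₂ → let open Mirror c; v = (v₁ , v₂) in
    :‖ v ‖ := :‖ v :⊖ :fromℤ (con (+ 2)) :· v ‖) refl c v₁ v₂

  -- w ω lies on the bisector of 0 and w (as ω = (1 + θ) / 2), and the bisector is parallel to w θ.
  bisector-det : ∀ y w → det (y ⊖ w · ω) (w · θ) ≡ ‖ y ‖ - ‖ y ⊖ w ‖
  bisector-det (y₁ , y₂) (w₁ , w₂) =
    solve 5 (λ c y₁ y₂ w₁ w₂ → let open Mirror c; y = (y₁ , y₂); w = (w₁ , w₂)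
                               in :det (y :⊖ w :· :ω) (w :· :θ) := :‖ y ‖ :- :‖ y :⊖ w ‖) refl c y₁ y₂ w₁ w₂

  parallelogram-identity : ∀ α y v p →
    ‖ α ‖ * (‖ v ⊖ fromℤ (+ 2) · p ‖ - ‖ v ‖) ≡
    + 2 * ((‖ y ⊖ α · p ‖ - ‖ y ‖) + (‖ y ⊖ α · (v ⊖ p) ‖ - ‖ y ‖) + (‖ y ‖ - ‖ y ⊖ α · v ‖))
  parallelogram-identity (a , b) (y₁ , y₂) (v₁ , v₂) (p₁ , p₂) =
    solve 9 (λ c a b y₁ y₂ v₁ v₂ p₁ p₂ → let open Mirror c
                                             α = (a , b); y = (y₁ , y₂); v = (v₁ , v₂); p = (p₁ , p₂)
                                         in :‖ α ‖ :* (:‖ v :⊖ :fromℤ (con (+ 2)) :· p ‖ :- :‖ v ‖)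
                                            := con (+ 2) :* ((:‖ y :⊖ α :· p ‖ :- :‖ y ‖)
                                                             :+ (:‖ y :⊖ α :· (v :⊖ p) ‖ :- :‖ y ‖)
                                                             :+ (:‖ y ‖ :- :‖ y :⊖ α :· v ‖)))
      refl c a b y₁ y₂ v₁ v₂ p₁ p₂

  -- Voronoi cells

  -- InCell α y: y lies in the Voronoi cell of 0 for αΛ.  InCell (fromℤ k) z: z / k lies in that for Λ.
  InCell : Zω → Zω → Set
  InCell α y = ∀ p → ‖ y ‖ ≤ ‖ y ⊖ α · p ‖

  OnEdge : Zω → Zω → Zω → Set
  OnEdge α v y = InCell α y × ‖ y ‖ ≡ ‖ y ⊖ α · v ‖

  Relevant : Zω → Set
  Relevant = InCell (fromℤ (+ 2))

  EdgeContent : Zω → Zω → ℤ → Set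
  EdgeContent α v k = ∃ λ γ → Primitive γ × k ∙ γ ≡ α · v · θ

  closer⇒¬InCell : ∀ α y p → ‖ y ⊖ α · p ‖ < ‖ y ‖ → ¬ InCell α y
  closer⇒¬InCell α y p closer cell = ℤₚ.<⇒≱ closer (cell p)

  2·closer⇒¬InCell : ∀ α y p → + 2 * ‖ y ⊖ α · p ‖ < + 2 * ‖ y ‖ → ¬ InCell α y
  2·closer⇒¬InCell α y p closer =
    closer⇒¬InCell α y p (ℤₚ.*-cancelˡ-<-nonNeg {‖ y ⊖ α · p ‖} {‖ y ‖} (+ 2) closer)

  scale-norm : ∀ D y α z → D ∙ y ≡ α · z → D * D * ‖ y ‖ ≡ ‖ α ‖ * ‖ z ‖
  scale-norm D y α z Dy≡αz = begin
    D * D * ‖ y ‖ ≡⟨ norm-∙ D y ⟨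
    ‖ D ∙ y ‖     ≡⟨ cong ‖_‖ Dy≡αz ⟩
    ‖ α · z ‖     ≡⟨ norm-· α z ⟩
    ‖ α ‖ * ‖ z ‖ ∎

  scale-⊖ : ∀ D y α z → D ∙ y ≡ α · z → ∀ p → D ∙ (y ⊖ α · p) ≡ α · (z ⊖ fromℤ D · p)
  scale-⊖ D y α z Dy≡αz p = begin
    D ∙ (y ⊖ α · p)           ≡⟨ ∙-⊖-· D y α p ⟩
    D ∙ y ⊖ α · (fromℤ D · p) ≡⟨ cong (_⊖ α · (fromℤ D · p)) Dy≡αz ⟩
    α · z ⊖ α · (fromℤ D · p) ≡⟨ ·-distribˡ-⊖ α z (fromℤ D · p) ⟨
    α · (z ⊖ fromℤ D · p)     ∎

  module _ (D : ℤ) (α y z : Zω) (D≢0 : D ≢ 0ℤ) (0<‖α‖ : 0ℤ < ‖ α ‖) (Dy≡αz : D ∙ y ≡ α · z) where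

    private
      scaled : D * D * ‖ y ‖ ≡ ‖ α ‖ * ‖ z ‖
      scaled = scale-norm D y α z Dy≡αz

      scaled-⊖ : ∀ p → D * D * ‖ y ⊖ α · p ‖ ≡ ‖ α ‖ * ‖ z ⊖ fromℤ D · p ‖
      scaled-⊖ p = scale-norm D (y ⊖ α · p) α (z ⊖ fromℤ D · p) (scale-⊖ D y α z Dy≡αz p)

    scale-cell⁺ : InCell α y → InCell (fromℤ D) z
    scale-cell⁺ cell p = scaled-≤ (0<i*i D≢0) 0<‖α‖ scaled (scaled-⊖ p) (cell p)

    scale-cell⁻ : InCell (fromℤ D) z → InCell α y
    scale-cell⁻ cell p = scaled-≤ 0<‖α‖ (0<i*i D≢0) (sym scaled) (sym (scaled-⊖ p)) (cell p)

    scale-edge⁻ : ∀ {v} → OnEdge (fromℤ D) v z → OnEdge α v y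
    scale-edge⁻ {v} (cell , bisects) =
      scale-cell⁻ cell , scaled-≡ ‖ α ‖ (ℤₚ.<⇒≢ (0<i*i D≢0) ∘ sym) (sym scaled) (sym (scaled-⊖ v)) bisects

  bisector-points : ∀ k γ w y → k ≢ 0ℤ → Primitive γ → k ∙ γ ≡ w · θ → ‖ y ‖ ≡ ‖ y ⊖ w ‖ →
                    ∃ λ j → y ≡ w · ω ⊕ j ∙ γ
  bisector-points k γ w y k≢0 prim kγ≡wθ bisects =
    proj₁ multiple , trans (sym (⊕-⊖-cancel (w · ω) y)) (cong (w · ω ⊕_) (proj₂ multiple))
    where
    k*det≡0 : k * det (y ⊖ w · ω) γ ≡ 0ℤ
    k*det≡0 = begin
      k * det (y ⊖ w · ω) γ   ≡⟨ det-∙ʳ (y ⊖ w · ω) k γ ⟨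
      det (y ⊖ w · ω) (k ∙ γ) ≡⟨ cong (det (y ⊖ w · ω)) kγ≡wθ ⟩
      det (y ⊖ w · ω) (w · θ) ≡⟨ bisector-det y w ⟩
      ‖ y ‖ - ‖ y ⊖ w ‖       ≡⟨ cong (λ t → ‖ y ‖ - t) bisects ⟨
      ‖ y ‖ - ‖ y ‖           ≡⟨ ℤₚ.+-inverseʳ ‖ y ‖ ⟩
      0ℤ                      ∎
    det≡0 : det (y ⊖ w · ω) γ ≡ 0ℤ
    det≡0 = [ (λ k≡0 → contradiction k≡0 k≢0) , id ]′ (ℤₚ.i*j≡0⇒i≡0∨j≡0 k {det (y ⊖ w · ω) γ} k*det≡0)
    multiple : ∃ λ j → y ⊖ w · ω ≡ j ∙ γ
    multiple = det≡0⇒multiple (y ⊖ w · ω) γ prim det≡0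

  scaled-bisector-point : ∀ k γ w j → k ∙ γ ≡ w · θ → k ∙ (w · ω ⊕ j ∙ γ) ≡ w · (k ∙ ω ⊕ j ∙ θ)
  scaled-bisector-point k γ w j kγ≡wθ = begin
    k ∙ (w · ω ⊕ j ∙ γ)       ≡⟨ ∙-distrib-⊕ k w j γ ⟩
    w · (k ∙ ω) ⊕ j ∙ (k ∙ γ) ≡⟨ cong (λ t → w · (k ∙ ω) ⊕ j ∙ t) kγ≡wθ ⟩
    w · (k ∙ ω) ⊕ j ∙ (w · θ) ≡⟨ ·-distribˡ-⊕-∙ w k j ⟩
    w · (k ∙ ω ⊕ j ∙ θ)       ∎

  edge-scaled : ∀ α v y k γ → 0ℤ < ‖ α ‖ → k ≢ 0ℤ → Primitive γ → k ∙ γ ≡ α · v · θ → OnEdge α v y →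
                ∃ λ j → InCell (fromℤ k) (v · (k ∙ ω ⊕ j ∙ θ))
  edge-scaled α v y k γ 0<‖α‖ k≢0 prim kγ≡ (cell , bisects) =
    j , scale-cell⁺ k α y (v · (k ∙ ω ⊕ j ∙ θ)) k≢0 0<‖α‖ k∙y≡ cell
    where
    points = bisector-points k γ (α · v) y k≢0 prim kγ≡ bisects
    j = proj₁ points
    k∙y≡ : k ∙ y ≡ α · (v · (k ∙ ω ⊕ j ∙ θ))
    k∙y≡ = trans (cong (k ∙_) (proj₂ points))
                 (trans (scaled-bisector-point k γ (α · v) j kγ≡) (·-assoc α v (k ∙ ω ⊕ j ∙ θ)))

  no-point-on-edge : ∀ α v k γ → 0ℤ < ‖ α ‖ → k ≢ 0ℤ → Primitive γ → k ∙ γ ≡ α · v · θ →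
                     (∀ j → ¬ InCell (fromℤ k) (v · (k ∙ ω ⊕ j ∙ θ))) → ∀ y → ¬ OnEdge α v y
  no-point-on-edge α v k γ 0<‖α‖ k≢0 prim kγ≡ outside y edge = outside (proj₁ scaled) (proj₂ scaled)
    where scaled = edge-scaled α v y k γ 0<‖α‖ k≢0 prim kγ≡ edge

  midpoint-on-edge : ∀ α v h γ → 0ℤ < ‖ α ‖ → h ≢ 0ℤ → (+ 2 * h) ∙ γ ≡ α · v · θ → Relevant v →
                     OnEdge α v (α · v · ω ⊕ (- h) ∙ γ)
  midpoint-on-edge α v h γ 0<‖α‖ h≢0 2hγ≡ relevant =
    scale-edge⁻ (+ 2) α y v (λ ()) 0<‖α‖ 2y≡αv (relevant , norm-⊖-2·self v)
    where
    y = α · v · ω ⊕ (- h) ∙ γ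
    2y≡αv : (+ 2) ∙ y ≡ α · v
    2y≡αv = ∙-cancel h h≢0 (begin
      h ∙ ((+ 2) ∙ y)                     ≡⟨ ∙-∙ h (+ 2) y ⟩
      (+ 2 * h) ∙ y                       ≡⟨ scaled-bisector-point (+ 2 * h) γ (α · v) (- h) 2hγ≡ ⟩
      α · v · ((+ 2 * h) ∙ ω ⊕ (- h) ∙ θ) ≡⟨ ·-midpoint (α · v) h ⟩
      h ∙ (α · v)                         ∎)

  edge-⊝ : ∀ α v y → OnEdge α v y → OnEdge α (⊝ v) (⊝ y)
  edge-⊝ α v y (cell , bisects) = cell-⊝ , (begin
    ‖ ⊝ y ‖           ≡⟨ norm-⊝ y ⟩
    ‖ y ‖             ≡⟨ bisects ⟩
    ‖ y ⊖ α · v ‖     ≡⟨ cong (λ t → ‖ y ⊖ α · t ‖) (⊝-involutive v) ⟨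
    ‖ y ⊖ α · ⊝ ⊝ v ‖ ≡⟨ norm-⊝-⊖ y α (⊝ v) ⟨
    ‖ ⊝ y ⊖ α · ⊝ v ‖ ∎)
    where
    cell-⊝ : InCell α (⊝ y)
    cell-⊝ p = subst₂ _≤_ (sym (norm-⊝ y)) (sym (norm-⊝-⊖ y α p)) (cell (⊝ p))

  relevant-⊝ : ∀ v → Relevant v → Relevant (⊝ v)
  relevant-⊝ v relevant p =
    subst₂ _≤_ (sym (norm-⊝ v)) (sym (norm-⊝-⊖ v (fromℤ (+ 2)) p)) (relevant (⊝ p))

  edge⇒relevant : ∀ α v y → 0ℤ < ‖ α ‖ → OnEdge α v y → Relevant v
  edge⇒relevant α v y 0<‖α‖ (cell , bisects) p =
    ℤₚ.0≤i-j⇒j≤i (ℤₚ.*-cancelˡ-≤-pos 0ℤ _ ‖ α ‖ {{ℤ.positive 0<‖α‖}}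
      (subst₂ _≤_ (sym (ℤₚ.*-zeroʳ ‖ α ‖)) (sym (parallelogram-identity α y v p)) 0≤rhs))
    where
    0≤rhs = 0≤i*j (0≤+ 2) (0≤i+j (0≤i+j (ℤₚ.i≤j⇒0≤j-i (cell p)) (ℤₚ.i≤j⇒0≤j-i (cell (v ⊖ p))))
                                   (ℤₚ.i≤j⇒0≤j-i (ℤₚ.≤-reflexive (sym bisects))))

  not-clean : ∀ α v y → OnEdge α v y → α · v ≢ 0ω → ¬ Clean N α
  not-clean α v y (cell , bisects) αv≢0 clean =
    clean y 0ω (cell′ , v , αv≢0 ∘ (λ αv≡α0 → trans αv≡α0 (·-zeroʳ α)) , trans ‖y⊖α0‖≡ bisects)
    where
    ‖y⊖α0‖≡ : ‖ y ⊖ α · 0ω ‖ ≡ ‖ y ‖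
    ‖y⊖α0‖≡ = cong ‖_‖ (trans (cong (y ⊖_) (·-zeroʳ α)) (⊖-identityʳ y))
    cell′ : InVoronoiCell N α (α · 0ω) y
    cell′ ρ = subst (_≤ ‖ y ⊖ α · ρ ‖) (sym ‖y⊖α0‖≡) (cell ρ)

  quotient⇔edge-content : ∀ α v k x → x ≡ ⊝ ((+ 2) ∙ (α · v · θ)) →
                          IntegralPrimitiveQuot N x (+ 2 * k) ⇔ EdgeContent α v k
  quotient⇔edge-content α v k x x≡ = mk⇔
    (λ (γ , 2kγ≡x , prim) → ⊝ γ , primitive-⊝ γ prim ,
       ∙-cancel (+ 2) (λ ()) (⊝-injective (trans (sym (2k-quotient k γ)) (trans 2kγ≡x x≡))))
    (λ (γ , prim , kγ≡) → ⊝ γ , (begin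
       fromℤ (+ 2 * k) · ⊝ γ   ≡⟨ 2k-quotient k (⊝ γ) ⟩
       ⊝ ((+ 2) ∙ (k ∙ ⊝ ⊝ γ)) ≡⟨ cong (λ t → ⊝ ((+ 2) ∙ (k ∙ t))) (⊝-involutive γ) ⟩
       ⊝ ((+ 2) ∙ (k ∙ γ))     ≡⟨ cong (λ t → ⊝ ((+ 2) ∙ t)) kγ≡ ⟩
       ⊝ ((+ 2) ∙ (α · v · θ)) ≡⟨ x≡ ⟨
       x                       ∎) , primitive-⊝ γ prim)

  module _ (1≤c : 1ℤ ≤ c) where

    0≤c-1 : 0ℤ ≤ c - 1ℤ
    0≤c-1 = ℤₚ.i≤j⇒0≤j-i 1≤c

    0≤4c-1 : 0ℤ ≤ + 4 * c - 1ℤ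
    0≤4c-1 = subst (0ℤ ≤_)
      (solve 1 (λ c → con (+ 4) :* (c :- con 1ℤ) :+ con (+ 3) := con (+ 4) :* c :- con 1ℤ) refl c)
      (0≤i+j (0≤i*j (0≤+ 4) 0≤c-1) (0≤+ 3))

    0≤4c-2 : 0ℤ ≤ + 4 * (c - 1ℤ) + + 2
    0≤4c-2 = 0≤i+j (0≤i*j (0≤+ 4) 0≤c-1) (0≤+ 2)

    norm-pos : ∀ x → x ≢ 0ω → 0ℤ < ‖ x ‖
    norm-pos (a , b) x≢0 with b ℤₚ.≟ 0ℤ
    ... | yes refl = <-by _ (ℤₚ.i≤j⇒0≤j-i (1≤i*i (λ a≡0 → x≢0 (cong (_, 0ℤ) a≡0))))
      (solve 2 (λ c a → let open Mirror c in
        con 1ℤ :+ con 0ℤ :+ (a :* a :- con 1ℤ) := :‖ (a , con 0ℤ) ‖) refl c a)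
    ... | no b≢0 = ℤₚ.*-cancelˡ-<-nonNeg {0ℤ} {‖ (a , b) ‖} (+ 4) (<-by _ 0≤d
      (solve 3 (λ c a b → let open Mirror c in
        con 1ℤ :+ con 0ℤ :+ ((con (+ 2) :* a :+ b) :* (con (+ 2) :* a :+ b)
                             :+ (con (+ 4) :* c :- con 1ℤ) :* (b :* b :- con 1ℤ)
                             :+ (con (+ 4) :* (c :- con 1ℤ) :+ con (+ 2)))
        := con (+ 4) :* :‖ (a , b) ‖) refl c a b))
      where
      0≤d = 0≤i+j (0≤i+j (0≤i*i (+ 2 * a + b)) (0≤i*j 0≤4c-1 (ℤₚ.i≤j⇒0≤j-i (1≤i*i b≢0)))) 0≤4c-2

    ·-nonzero : ∀ x y → x ≢ 0ω → y ≢ 0ω → x · y ≢ 0ω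
    ·-nonzero x y x≢0 y≢0 xy≡0 =
      [ ℤₚ.<⇒≢ (norm-pos x x≢0) ∘ sym , ℤₚ.<⇒≢ (norm-pos y y≢0) ∘ sym ]′
        (ℤₚ.i*j≡0⇒i≡0∨j≡0 ‖ x ‖ {‖ y ‖} (trans (sym (norm-· x y)) (trans (cong ‖_‖ xy≡0) norm-0ω)))

    -- Voronoi-relevant vectors of Λ

    relevant-1 : Relevant 1ω
    relevant-1 (p₁ , p₂) with p₂ ℤₚ.≟ 0ℤ
    ... | yes refl = ≤-by _ (0≤i*j (0≤+ 4) (0≤i*[i+1] (p₁ - 1ℤ)))
      (solve 2 (λ c p₁ → let open Mirror c in
        :‖ :1ω ‖ :+ con (+ 4) :* ((p₁ :- con 1ℤ) :* (p₁ :- con 1ℤ :+ con 1ℤ))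
        := :‖ :1ω :⊖ :fromℤ (con (+ 2)) :· (p₁ , con 0ℤ) ‖) refl c p₁)
    ... | no p₂≢0 = ≤-by _ 0≤d
      (solve 3 (λ c p₁ p₂ → let open Mirror c; m = con 1ℤ :- con (+ 2) :* p₁ :- p₂ in
        :‖ :1ω ‖ :+ (m :* m :+ (con (+ 4) :* c :- con 1ℤ) :* (p₂ :* p₂ :- con 1ℤ)
                     :+ (con (+ 4) :* (c :- con 1ℤ) :+ con (+ 2)))
        := :‖ :1ω :⊖ :fromℤ (con (+ 2)) :· (p₁ , p₂) ‖) refl c p₁ p₂)
      where
      0≤d = 0≤i+j (0≤i+j (0≤i*i (1ℤ - + 2 * p₁ - p₂)) (0≤i*j 0≤4c-1 (ℤₚ.i≤j⇒0≤j-i (1≤i*i p₂≢0)))) 0≤4c-2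

    relevant-ω : Relevant ω
    relevant-ω (p₁ , p₂) =
      ≤-by _ (0≤i+j (0≤i*[i+1] (- (+ 2 * p₁ + p₂))) (0≤i*j 0≤4c-1 (0≤i*[i+1] (- p₂))))
      (solve 3 (λ c p₁ p₂ → let open Mirror c; i = :- (con (+ 2) :* p₁ :+ p₂); j = :- p₂ in
        :‖ :ω ‖ :+ (i :* (i :+ con 1ℤ) :+ (con (+ 4) :* c :- con 1ℤ) :* (j :* (j :+ con 1ℤ)))
        := :‖ :ω :⊖ :fromℤ (con (+ 2)) :· (p₁ , p₂) ‖) refl c p₁ p₂)

    relevant-ω-1 : Relevant ω-1
    relevant-ω-1 (p₁ , p₂) =
      ≤-by _ (0≤i+j (0≤i*[i+1] (+ 2 * p₁ + p₂)) (0≤i*j 0≤4c-1 (0≤i*[i+1] (- p₂))))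
      (solve 3 (λ c p₁ p₂ → let open Mirror c; s = con (+ 2) :* p₁ :+ p₂; j = :- p₂ in
        :‖ :ω :⊖ :1ω ‖ :+ (s :* (s :+ con 1ℤ) :+ (con (+ 4) :* c :- con 1ℤ) :* (j :* (j :+ con 1ℤ)))
        := :‖ (:ω :⊖ :1ω) :⊖ :fromℤ (con (+ 2)) :· (p₁ , p₂) ‖) refl c p₁ p₂)

    relevant⇒direction⁺ : ∀ v₁ n → Relevant (v₁ , + n) → (v₁ , + n) ≢ 0ω →
                          Direction (v₁ , + n) ⊎ Direction (⊝ (v₁ , + n))
    relevant⇒direction⁺ v₁ (suc (suc m)) relevant _ =
      contradiction (ℤₚ.+-mono-≤ (relevant ω) (relevant ω-1)) (ℤₚ.<⇒≱ (<-by _ 0≤d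
        (solve 3 (λ c v₁ x → let open Mirror c; v = (v₁ , con (+ 2) :+ x); A = con (+ 4) :* c :- con 1ℤ in
          con 1ℤ :+ (:‖ v :⊖ :fromℤ (con (+ 2)) :· :ω ‖ :+ :‖ v :⊖ :fromℤ (con (+ 2)) :· (:ω :⊖ :1ω) ‖)
                 :+ (con (+ 8) :* (c :- con 1ℤ) :+ con (+ 3) :+ con (+ 2) :* A :* x)
          := :‖ v ‖ :+ :‖ v ‖) refl c v₁ (+ m))))
      where
      0≤d = 0≤i+j (0≤i+j (0≤i*j (0≤+ 8) 0≤c-1) (0≤+ 3)) (0≤i*j (0≤i*j (0≤+ 2) 0≤4c-1) (0≤+ m))
    relevant⇒direction⁺ (+ zero)        0 _ v≢0 = contradiction refl v≢0
    relevant⇒direction⁺ (+ 1)           0 _ _   = inj₁ dir-1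
    relevant⇒direction⁺ -[1+ zero ]     0 _ _   = inj₂ dir-1
    relevant⇒direction⁺ (+ suc (suc m)) 0 relevant _ = contradiction relevant
      (closer⇒¬InCell (fromℤ (+ 2)) (+ suc (suc m) , 0ℤ) 1ω (<-by _ (0≤i+j (0≤+ 3) (0≤i*j (0≤+ 4) (0≤+ m)))
        (solve 2 (λ c x → let open Mirror c; v = (con (+ 2) :+ x , con 0ℤ) in
          con 1ℤ :+ :‖ v :⊖ :fromℤ (con (+ 2)) :· :1ω ‖ :+ (con (+ 3) :+ con (+ 4) :* x) := :‖ v ‖)
          refl c (+ m))))
    relevant⇒direction⁺ -[1+ suc m ]    0 relevant _ = contradiction relevant
      (closer⇒¬InCell (fromℤ (+ 2)) (-[1+ suc m ] , 0ℤ) (⊝ 1ω) (<-by _ (0≤i+j (0≤+ 3) (0≤i*j (0≤+ 4) (0≤+ m)))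
        (solve 2 (λ c x → let open Mirror c; v = (:- (con (+ 2) :+ x) , con 0ℤ) in
          con 1ℤ :+ :‖ v :⊖ :fromℤ (con (+ 2)) :· :⊝ :1ω ‖ :+ (con (+ 3) :+ con (+ 4) :* x) := :‖ v ‖)
          refl c (+ m))))
    relevant⇒direction⁺ (+ zero)        1 _ _   = inj₁ dir-ω
    relevant⇒direction⁺ -[1+ zero ]     1 _ _   = inj₁ dir-ω-1
    relevant⇒direction⁺ (+ suc m)       1 relevant _ = contradiction relevant
      (closer⇒¬InCell (fromℤ (+ 2)) (+ suc m , 1ℤ) 1ω (<-by _ (0≤i+j (0≤+ 1) (0≤i*j (0≤+ 4) (0≤+ m)))
        (solve 2 (λ c x → let open Mirror c; v = (con 1ℤ :+ x , con 1ℤ) in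
          con 1ℤ :+ :‖ v :⊖ :fromℤ (con (+ 2)) :· :1ω ‖ :+ (con 1ℤ :+ con (+ 4) :* x) := :‖ v ‖)
          refl c (+ m))))
    relevant⇒direction⁺ -[1+ suc m ]    1 relevant _ = contradiction relevant
      (closer⇒¬InCell (fromℤ (+ 2)) (-[1+ suc m ] , 1ℤ) (⊝ 1ω) (<-by _ (0≤i+j (0≤+ 1) (0≤i*j (0≤+ 4) (0≤+ m)))
        (solve 2 (λ c x → let open Mirror c; v = (:- (con (+ 2) :+ x) , con 1ℤ) in
          con 1ℤ :+ :‖ v :⊖ :fromℤ (con (+ 2)) :· :⊝ :1ω ‖ :+ (con 1ℤ :+ con (+ 4) :* x) := :‖ v ‖)
          refl c (+ m))))

    relevant⇒direction : ∀ v → Relevant v → v ≢ 0ω → Direction v ⊎ Direction (⊝ v)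
    relevant⇒direction (v₁ , + n) = relevant⇒direction⁺ v₁ n
    relevant⇒direction (v₁ , -[1+ n ]) relevant _ =
      [ inj₂ , inj₁ ∘ subst Direction (⊝-involutive (v₁ , -[1+ n ])) ]′
        (relevant⇒direction⁺ (- v₁) (suc n) (relevant-⊝ (v₁ , -[1+ n ]) relevant)
                             (λ eq → case cong proj₂ eq of λ ()))

    -- Edges of the Voronoi cell of Λ

    no-point-on-1-edge : ∀ j → ¬ InCell (fromℤ 1ℤ) (1ω · (1ℤ ∙ ω ⊕ j ∙ θ))
    no-point-on-1-edge (+ n) =
      closer⇒¬InCell (fromℤ 1ℤ) (1ω · (1ℤ ∙ ω ⊕ (+ n) ∙ θ)) ω (<-by _ (0≤i+j 0≤c-1 (0≤i*j 0≤4c-1 (0≤+ n)))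
        (solve 2 (λ c x → let open Mirror c; z = :1ω :· (con 1ℤ :∙ :ω :⊕ x :∙ :θ) in
          con 1ℤ :+ :‖ z :⊖ :fromℤ (con 1ℤ) :· :ω ‖ :+ (c :- con 1ℤ :+ (con (+ 4) :* c :- con 1ℤ) :* x)
          := :‖ z ‖) refl c (+ n)))
    no-point-on-1-edge -[1+ n ] =
      closer⇒¬InCell (fromℤ 1ℤ) (1ω · (1ℤ ∙ ω ⊕ -[1+ n ] ∙ θ)) (1ω ⊖ ω) (<-by _ (0≤i+j 0≤c-1 (0≤i*j 0≤4c-1 (0≤+ n)))
        (solve 2 (λ c x → let open Mirror c; z = :1ω :· (con 1ℤ :∙ :ω :⊕ (:- (con 1ℤ :+ x)) :∙ :θ) in
          con 1ℤ :+ :‖ z :⊖ :fromℤ (con 1ℤ) :· (:1ω :⊖ :ω) ‖ :+ (c :- con 1ℤ :+ (con (+ 4) :* c :- con 1ℤ) :* x)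
          := :‖ z ‖) refl c (+ n)))

    -- For odd k ≤ 2c the point z / k lies beyond an end of the edge (which end depends on the
    -- sign of 2j + k), and a lattice point adjacent to that end is strictly closer to it than 0.
    module _ (h : ℤ) (0≤h : 0ℤ ≤ h) (k≤2c : 1ℤ + + 2 * h ≤ + 2 * c) where

      private
        k : ℤ
        k = 1ℤ + + 2 * h

        0≤k : 0ℤ ≤ k
        0≤k = 0≤i+j (0≤+ 1) (0≤i*j (0≤+ 2) 0≤h)

        0≤d : ∀ {e} → 0ℤ ≤ e → 0ℤ ≤ k * (+ 2 * (+ 4 * c - 1ℤ) * e + (+ 2 * c - k) + + 2 * (c - 1ℤ)) + + 2 * h
        0≤d 0≤e = 0≤i+j (0≤i*j 0≤k (0≤i+j (0≤i+j (0≤i*j (0≤i*j (0≤+ 2) 0≤4c-1) 0≤e) (ℤₚ.i≤j⇒0≤j-i k≤2c))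
                                           (0≤i*j (0≤+ 2) 0≤c-1)))
                        (0≤i*j (0≤+ 2) 0≤h)

      no-point-on-ω-edge : ∀ j → ¬ InCell (fromℤ k) (ω · (k ∙ ω ⊕ j ∙ θ))
      no-point-on-ω-edge j =
        [ 2·closer⇒¬InCell (fromℤ k) z ω-1 ∘ past , 2·closer⇒¬InCell (fromℤ k) z 1ω ∘ before ]′
          (0≤⊎0≤-i-1 (j + h))
        where
        z = ω · (k ∙ ω ⊕ j ∙ θ)
        past : 0ℤ ≤ j + h → + 2 * ‖ z ⊖ fromℤ k · ω-1 ‖ < + 2 * ‖ z ‖
        past 0≤e = <-by _ (0≤d 0≤e)
          (solve 3 (λ c h j → let open Mirror c
                                  k = con 1ℤ :+ con (+ 2) :* h
                                  z = :ω :· (k :∙ :ω :⊕ j :∙ :θ)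
                                  e = j :+ h
                                  A = con (+ 4) :* c :- con 1ℤ
                              in con 1ℤ :+ con (+ 2) :* :‖ z :⊖ :fromℤ k :· (:ω :⊖ :1ω) ‖
                                 :+ (k :* (con (+ 2) :* A :* e :+ (con (+ 2) :* c :- k) :+ con (+ 2) :* (c :- con 1ℤ))
                                     :+ con (+ 2) :* h)
                              := con (+ 2) :* :‖ z ‖)
            refl c h j)
        before : 0ℤ ≤ - (j + h) - 1ℤ → + 2 * ‖ z ⊖ fromℤ k · 1ω ‖ < + 2 * ‖ z ‖
        before 0≤e = <-by _ (0≤d 0≤e)
          (solve 3 (λ c h j → let open Mirror c
                                  k = con 1ℤ :+ con (+ 2) :* h
                                  z = :ω :· (k :∙ :ω :⊕ j :∙ :θ)
                                  e = :- (j :+ h) :- con 1ℤ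
                                  A = con (+ 4) :* c :- con 1ℤ
                              in con 1ℤ :+ con (+ 2) :* :‖ z :⊖ :fromℤ k :· :1ω ‖
                                 :+ (k :* (con (+ 2) :* A :* e :+ (con (+ 2) :* c :- k) :+ con (+ 2) :* (c :- con 1ℤ))
                                     :+ con (+ 2) :* h)
                              := con (+ 2) :* :‖ z ‖)
            refl c h j)

      no-point-on-ω-1-edge : ∀ j → ¬ InCell (fromℤ k) (ω-1 · (k ∙ ω ⊕ j ∙ θ))
      no-point-on-ω-1-edge j =
        [ 2·closer⇒¬InCell (fromℤ k) z (⊝ 1ω) ∘ past , 2·closer⇒¬InCell (fromℤ k) z ω ∘ before ]′
          (0≤⊎0≤-i-1 (j + h))
        where
        z = ω-1 · (k ∙ ω ⊕ j ∙ θ)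
        past : 0ℤ ≤ j + h → + 2 * ‖ z ⊖ fromℤ k · (⊝ 1ω) ‖ < + 2 * ‖ z ‖
        past 0≤e = <-by _ (0≤d 0≤e)
          (solve 3 (λ c h j → let open Mirror c
                                  k = con 1ℤ :+ con (+ 2) :* h
                                  z = (:ω :⊖ :1ω) :· (k :∙ :ω :⊕ j :∙ :θ)
                                  e = j :+ h
                                  A = con (+ 4) :* c :- con 1ℤ
                              in con 1ℤ :+ con (+ 2) :* :‖ z :⊖ :fromℤ k :· :⊝ :1ω ‖
                                 :+ (k :* (con (+ 2) :* A :* e :+ (con (+ 2) :* c :- k) :+ con (+ 2) :* (c :- con 1ℤ))
                                     :+ con (+ 2) :* h)
                              := con (+ 2) :* :‖ z ‖)
            refl c h j)
        before : 0ℤ ≤ - (j + h) - 1ℤ → + 2 * ‖ z ⊖ fromℤ k · ω ‖ < + 2 * ‖ z ‖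
        before 0≤e = <-by _ (0≤d 0≤e)
          (solve 3 (λ c h j → let open Mirror c
                                  k = con 1ℤ :+ con (+ 2) :* h
                                  z = (:ω :⊖ :1ω) :· (k :∙ :ω :⊕ j :∙ :θ)
                                  e = :- (j :+ h) :- con 1ℤ
                                  A = con (+ 4) :* c :- con 1ℤ
                              in con 1ℤ :+ con (+ 2) :* :‖ z :⊖ :fromℤ k :· :ω ‖
                                 :+ (k :* (con (+ 2) :* A :* e :+ (con (+ 2) :* c :- k) :+ con (+ 2) :* (c :- con 1ℤ))
                                     :+ con (+ 2) :* h)
                              := con (+ 2) :* :‖ z ‖)
            refl c h j)

    module _ (g : ℤ) (0≤g : 0ℤ ≤ g) where

      private
        h k : ℤ
        h = 1ℤ + g
        k = 1ℤ + + 2 * h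

        0≤k : 0ℤ ≤ k
        0≤k = 0≤i+j (0≤+ 1) (0≤i*j (0≤+ 2) (0≤i+j (0≤+ 1) 0≤g))

      odd-point-on-1-edge : OnEdge (fromℤ k) 1ω (1ω · (k ∙ ω ⊕ (- h) ∙ θ))
      odd-point-on-1-edge = cell , bisects
        where
        z = 1ω · (k ∙ ω ⊕ (- h) ∙ θ)
        cell : InCell (fromℤ k) z
        cell (p₁ , + zero) = ≤-by _ (0≤i*j (0≤i*i k) (0≤i*[i+1] (p₁ - 1ℤ)))
          (solve 3 (λ c g p₁ → let open Mirror c
                                   h = con 1ℤ :+ g
                                   k = con 1ℤ :+ con (+ 2) :* h
                                   z = :1ω :· (k :∙ :ω :⊕ (:- h) :∙ :θ)
                               in :‖ z ‖ :+ k :* k :* ((p₁ :- con 1ℤ) :* (p₁ :- con 1ℤ :+ con 1ℤ))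
                               := :‖ z :⊖ :fromℤ k :· (p₁ , con 0ℤ) ‖)
            refl c g p₁)
        cell (p₁ , + suc n) = ℤₚ.*-cancelˡ-≤-pos _ _ (+ 4) (≤-by _ 0≤d
          (solve 4 (λ c g p₁ x → let open Mirror c
                                     h = con 1ℤ :+ g
                                     k = con 1ℤ :+ con (+ 2) :* h
                                     z = :1ω :· (k :∙ :ω :⊕ (:- h) :∙ :θ)
                                     A = con (+ 4) :* c :- con 1ℤ
                                     m = con 1ℤ :- con (+ 2) :* p₁ :- (con 1ℤ :+ x)
                                 in con (+ 4) :* :‖ z ‖
                                   :+ (k :* k :* (m :* m) :+ con (+ 4) :* k :* g
                                       :+ con (+ 4) :* (c :- con 1ℤ) :* k :* (con 1ℤ :+ con (+ 2) :* g)
                                       :+ A :* (con (+ 2) :* k :* (con (+ 2) :+ con (+ 2) :* g) :* x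
                                                :+ k :* k :* (x :* x)))
                                 := con (+ 4) :* :‖ z :⊖ :fromℤ k :· (p₁ , con 1ℤ :+ x) ‖)
            refl c g p₁ (+ n)))
          where
          x = + n
          0≤d = 0≤i+j (0≤i+j (0≤i+j (0≤i*j (0≤i*i k) (0≤i*i (1ℤ - + 2 * p₁ - (1ℤ + x))))
                                    (0≤i*j (0≤i*j (0≤+ 4) 0≤k) 0≤g))
                            (0≤i*j (0≤i*j (0≤i*j (0≤+ 4) 0≤c-1) 0≤k) (0≤i+j (0≤+ 1) (0≤i*j (0≤+ 2) 0≤g))))
                    (0≤i*j 0≤4c-1 (0≤i+j (0≤i*j (0≤i*j (0≤i*j (0≤+ 2) 0≤k) (0≤i+j (0≤+ 2) (0≤i*j (0≤+ 2) 0≤g)))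
                                                (0≤+ n))
                                         (0≤i*j (0≤i*i k) (0≤i*i x))))
        cell (p₁ , -[1+ n ]) = ℤₚ.*-cancelˡ-≤-pos _ _ (+ 4) (≤-by _ 0≤d
          (solve 4 (λ c g p₁ x → let open Mirror c
                                     h = con 1ℤ :+ g
                                     k = con 1ℤ :+ con (+ 2) :* h
                                     z = :1ω :· (k :∙ :ω :⊕ (:- h) :∙ :θ)
                                     A = con (+ 4) :* c :- con 1ℤ
                                     m = con 1ℤ :- con (+ 2) :* p₁ :+ (con 1ℤ :+ x)
                                 in con (+ 4) :* :‖ z ‖
                                   :+ (k :* k :* (m :* m)
                                       :+ k :* k :* (con (+ 4) :* (c :- con 1ℤ) :+ con (+ 2)
                                                     :+ A :* (con (+ 2) :* x :+ x :* x))
                                       :+ con (+ 2) :* A :* k :* (con 1ℤ :+ x))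
                                 := con (+ 4) :* :‖ z :⊖ :fromℤ k :· (p₁ , :- (con 1ℤ :+ x)) ‖)
            refl c g p₁ (+ n)))
          where
          x = + n
          0≤d = 0≤i+j (0≤i+j (0≤i*j (0≤i*i k) (0≤i*i (1ℤ - + 2 * p₁ + (1ℤ + x))))
                            (0≤i*j (0≤i*i k) (0≤i+j 0≤4c-2 (0≤i*j 0≤4c-1 (0≤i+j (0≤i*j (0≤+ 2) (0≤+ n))
                                                                                  (0≤i*i x))))))
                    (0≤i*j (0≤i*j (0≤i*j (0≤+ 2) 0≤4c-1) 0≤k) (0≤+ (suc n)))
        bisects : ‖ z ‖ ≡ ‖ z ⊖ fromℤ k · 1ω ‖
        bisects =
          (solve 2 (λ c g → let open Mirror c
                                h = con 1ℤ :+ g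
                                k = con 1ℤ :+ con (+ 2) :* h
                                z = :1ω :· (k :∙ :ω :⊕ (:- h) :∙ :θ)
                            in :‖ z ‖ := :‖ z :⊖ :fromℤ k :· :1ω ‖)
            refl c g)

    -- Clean sublattices

    clean-if-edges-free : ∀ α → 0ℤ < ‖ α ‖ → (∀ v y → Direction v → ¬ OnEdge α v y) → Clean N α
    clean-if-edges-free α 0<‖α‖ edges-free x μ (cell , ν , αν≢αμ , equidistant) =
      [ (λ dir → edges-free v y dir edge) , (λ dir → edges-free (⊝ v) (⊝ y) dir (edge-⊝ α v y edge)) ]′
        (relevant⇒direction v (edge⇒relevant α v y 0<‖α‖ edge) v≢0)
      where
      y = x ⊖ α · μ
      v = ν ⊖ μ
      edge : OnEdge α v y
      edge = (λ p → subst (‖ y ‖ ≤_) (cong ‖_‖ (⊖-·-⊕ x α p μ)) (cell (p ⊕ μ))) ,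
             trans equidistant
               (cong ‖_‖ (trans (cong (λ t → x ⊖ α · t) (sym (⊖-⊕-cancel ν μ))) (⊖-·-⊕ x α v μ)))
      v≢0 : v ≢ 0ω
      v≢0 v≡0 = αν≢αμ (cong (α ·_) (⊖≡0⇒≡ ν μ v≡0))

    odd-content-point-on-edge : ∀ α g γ → 0ℤ < ‖ α ‖ → 0ℤ ≤ g → (1ℤ + + 2 * (1ℤ + g)) ∙ γ ≡ α · 1ω · θ →
                                OnEdge α 1ω (α · 1ω · ω ⊕ (- (1ℤ + g)) ∙ γ)
    odd-content-point-on-edge α g γ 0<‖α‖ 0≤g kγ≡ =
      scale-edge⁻ k α (α · 1ω · ω ⊕ (- (1ℤ + g)) ∙ γ) (1ω · (k ∙ ω ⊕ (- (1ℤ + g)) ∙ θ)) k≢0 0<‖α‖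
        (trans (scaled-bisector-point k γ (α · 1ω) (- (1ℤ + g)) kγ≡)
               (·-assoc α 1ω (k ∙ ω ⊕ (- (1ℤ + g)) ∙ θ)))
        (odd-point-on-1-edge g 0≤g)
      where
      k = 1ℤ + + 2 * (1ℤ + g)
      k≢0 : k ≢ 0ℤ
      k≢0 = ℤₚ.<⇒≢ (<-by _ (0≤i*j (0≤+ 2) (0≤i+j (0≤+ 1) 0≤g)) refl) ∘ sym

    clean⇒odd-content : ∀ α v → α ≢ 0ω → v ≢ 0ω → Relevant v → Clean N α →
                        ∃ λ h → EdgeContent α v (+ suc (2 ℕ.* h))
    clean⇒odd-content α v α≢0 v≢0 relevant clean = from-content (content (α · v · θ) αvθ≢0)
      where
      αv≢0 = ·-nonzero α v α≢0 v≢0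
      αvθ≢0 = ·-nonzero (α · v) θ αv≢0 (λ ())
      from-content : (∃₂ λ g γ → α · v · θ ≡ (+ suc g) ∙ γ × Primitive γ) →
                     ∃ λ h → EdgeContent α v (+ suc (2 ℕ.* h))
      from-content (g , γ , αvθ≡ , prim) = [ even , odd ]′ (parity (suc g))
        where
        even : (∃ λ h → suc g ≡ 2 ℕ.* h) → ∃ λ h → EdgeContent α v (+ suc (2 ℕ.* h))
        even (h , sg≡2h) = contradiction clean
          (not-clean α v (α · v · ω ⊕ (- + h) ∙ γ)
            (midpoint-on-edge α v (+ h) γ (norm-pos α α≢0) h≢0 2hγ≡ relevant) αv≢0)
          where
          h≢0 : + h ≢ 0ℤ
          h≢0 h≡0 = ℕₚ.1+n≢0 (trans sg≡2h (cong (2 ℕ.*_) (ℤₚ.+-injective h≡0)))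
          2hγ≡ : (+ 2 * + h) ∙ γ ≡ α · v · θ
          2hγ≡ = trans (cong (_∙ γ) (trans (sym (ℤₚ.pos-* 2 h)) (cong +_ (sym sg≡2h)))) (sym αvθ≡)
        odd : (∃ λ h → suc g ≡ suc (2 ℕ.* h)) → ∃ λ h → EdgeContent α v (+ suc (2 ℕ.* h))
        odd (h , sg≡) = h , γ , prim , trans (cong (λ n → (+ n) ∙ γ) (sym sg≡)) (sym αvθ≡)

    clean⇒primitive : ∀ α → α ≢ 0ω → Clean N α → Primitive (α · θ)
    clean⇒primitive α α≢0 clean = from-odd (clean⇒odd-content α 1ω α≢0 (λ ()) relevant-1 clean)
      where
      from-odd : (∃ λ h → EdgeContent α 1ω (+ suc (2 ℕ.* h))) → Primitive (α · θ)
      from-odd (zero , γ , prim , γ≡) = subst Primitive (sym αθ≡γ) prim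
        where
        αθ≡γ : α · θ ≡ γ
        αθ≡γ = begin
          α · θ       ≡⟨ cong (_· θ) (·-identityʳ α) ⟨
          α · 1ω · θ  ≡⟨ γ≡ ⟨
          1ℤ ∙ γ      ≡⟨ ∙-identityˡ γ ⟩
          γ           ∎
      from-odd (suc h , γ , prim , kγ≡) = contradiction clean
        (not-clean α 1ω (α · 1ω · ω ⊕ (- (1ℤ + + h)) ∙ γ)
          (odd-content-point-on-edge α (+ h) γ (norm-pos α α≢0) (0≤+ h)
            (trans (cong (_∙ γ) (sym (odd-ℤ (suc h)))) kγ≡))
          (·-nonzero α 1ω α≢0 (λ ())))

    clean⇒divisor-content : ∀ α v v′ → α ≢ 0ω → v ≢ 0ω → Relevant v → α · v · θ · v′ ≡ c ∙ (α · θ) →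
                            Clean N α → ∃ λ k → Odd k × (∃ λ t → c ≡ + k * t) × EdgeContent α v (+ k)
    clean⇒divisor-content α v v′ α≢0 v≢0 relevant αvθv′≡ clean =
      from-odd (clean⇒odd-content α v α≢0 v≢0 relevant clean)
      where
      from-odd : (∃ λ h → EdgeContent α v (+ suc (2 ℕ.* h))) →
                 ∃ λ k → Odd k × (∃ λ t → c ≡ + k * t) × EdgeContent α v (+ k)
      from-odd (h , γ , prim , kγ≡) =
        suc (2 ℕ.* h) , (h , refl) ,
        primitive-divisor (α · θ) (γ · v′) (+ suc (2 ℕ.* h)) c (clean⇒primitive α α≢0 clean) kγv′≡ ,
        γ , prim , kγ≡
        where
        kγv′≡ : (+ suc (2 ℕ.* h)) ∙ (γ · v′) ≡ c ∙ (α · θ)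
        kγv′≡ = trans (∙-·ˡ (+ suc (2 ℕ.* h)) γ v′) (trans (cong (_· v′) kγ≡) αvθv′≡)

    OddContent : Zω → Zω → Set
    OddContent α v = ∃ λ k → Odd k × + k ≤ + 2 * c × EdgeContent α v (+ k)

    clean-if : ∀ α → α ≢ 0ω → Primitive (α · θ) → OddContent α ω → OddContent α ω-1 → Clean N α
    clean-if α α≢0 primαθ (_ , (h₂ , refl) , k₂≤2c , γ₂ , prim₂ , eq₂)
                          (_ , (h₃ , refl) , k₃≤2c , γ₃ , prim₃ , eq₃) = clean-if-edges-free α 0<‖α‖ free
      where
      0<‖α‖ = norm-pos α α≢0
      odd≢0 : ∀ h → + suc (2 ℕ.* h) ≢ 0ℤ
      odd≢0 h ()
      free : ∀ v y → Direction v → ¬ OnEdge α v y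
      free _ y dir-1   =
        no-point-on-edge α 1ω 1ℤ (α · θ) 0<‖α‖ (λ ()) primαθ (unit-edge-content α) no-point-on-1-edge y
      free _ y dir-ω   = no-point-on-edge α ω (+ suc (2 ℕ.* h₂)) γ₂ 0<‖α‖ (odd≢0 h₂) prim₂ eq₂
        (subst (λ k → ∀ j → ¬ InCell (fromℤ k) (ω · (k ∙ ω ⊕ j ∙ θ))) (sym (odd-ℤ h₂))
          (no-point-on-ω-edge (+ h₂) (0≤+ h₂) (subst (_≤ + 2 * c) (odd-ℤ h₂) k₂≤2c))) y
      free _ y dir-ω-1 = no-point-on-edge α ω-1 (+ suc (2 ℕ.* h₃)) γ₃ 0<‖α‖ (odd≢0 h₃) prim₃ eq₃
        (subst (λ k → ∀ j → ¬ InCell (fromℤ k) (ω-1 · (k ∙ ω ⊕ j ∙ θ))) (sym (odd-ℤ h₃))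
          (no-point-on-ω-1-edge (+ h₃) (0≤+ h₃) (subst (_≤ + 2 * c) (odd-ℤ h₃) k₃≤2c))) y

module Mod4 (N : ℕ) (N%4≡3 : N % 4 ≡ 3) where

  open Lattice N using (c)

  private
    q : ℕ
    q = N ℕ./ 4

  suc-N≡ : suc N ≡ suc q ℕ.* 4
  suc-N≡ = cong suc (trans (ℕ.m≡m%n+[m/n]*n N 4) (cong (ℕ._+ q ℕ.* 4) N%4≡3))

  c≡ : c ≡ + suc q
  c≡ = cong +_ (trans (cong (ℕ._/ 4) suc-N≡) (ℕ.m*n/n≡m (suc q) 4))

  1≤c : 1ℤ ≤ c
  1≤c = subst (1ℤ ≤_) (sym c≡) (+≤+ (s≤s z≤n))

  4c≡ : + 4 * c ≡ + suc N
  4c≡ = trans (cong (+ 4 *_) c≡)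
              (trans (sym (ℤₚ.pos-* 4 (suc q))) (cong +_ (trans (ℕₚ.*-comm 4 (suc q)) (sym suc-N≡))))

  N≡4c-1 : + N ≡ + 4 * c - 1ℤ
  N≡4c-1 = trans (solve 1 (λ n → n := con 1ℤ :+ n :- con 1ℤ) refl (+ N)) (cong (_- 1ℤ) (sym 4c≡))

  odd-divisor-bound : ∀ k → Odd k → k ∣ suc N → + k ≤ + 2 * c
  odd-divisor-bound k _        (divides zero eq)          = contradiction eq ℕₚ.1+n≢0
  odd-divisor-bound k (h , k≡) (divides (suc zero) eq)    = contradiction (begin
    2 ℕ.* (suc q ℕ.* 2) ≡⟨ ℕₚ.*-comm 2 (suc q ℕ.* 2) ⟩
    suc q ℕ.* 2 ℕ.* 2   ≡⟨ ℕₚ.*-assoc (suc q) 2 2 ⟩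
    suc q ℕ.* 4         ≡⟨ suc-N≡ ⟨
    suc N               ≡⟨ trans eq (ℕₚ.+-identityʳ k) ⟩
    k                   ≡⟨ k≡ ⟩
    suc (2 ℕ.* h)       ∎) (ℕₚ.even≢odd (suc q ℕ.* 2) h)
  odd-divisor-bound k _        (divides (suc (suc r)) eq) =
    ℤₚ.*-cancelˡ-≤-pos (+ k) (+ 2 * c) (+ 2) (≤-by (+ r * + k) (0≤i*j (0≤+ r) (0≤+ k)) (begin
      + 2 * + k + + r * + k   ≡⟨ solve 2 (λ r k → con (+ 2) :* k :+ r :* k := (con (+ 2) :+ r) :* k)
                                         refl (+ r) (+ k) ⟩
      (+ 2 + + r) * + k       ≡⟨ ℤₚ.pos-* (suc (suc r)) k ⟨
      + (suc (suc r) ℕ.* k)   ≡⟨ cong +_ eq ⟨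
      + suc N                 ≡⟨ 4c≡ ⟨
      + 4 * c                 ≡⟨ solve 1 (λ c → con (+ 4) :* c := con (+ 2) :* (con (+ 2) :* c)) refl c ⟩
      + 2 * (+ 2 * c)         ∎))

  divisor-of-c : ∀ k t → c ≡ + k * t → k ∣ suc N
  divisor-of-c k t c≡kt = divides ((∣ t ∣) ℕ.* 4) (begin
    suc N                    ≡⟨ suc-N≡ ⟩
    suc q ℕ.* 4              ≡⟨ cong (ℕ._* 4) (trans (cong ∣_∣ (trans (sym c≡) c≡kt)) (ℤₚ.abs-* (+ k) t)) ⟩
    k ℕ.* (∣ t ∣) ℕ.* 4      ≡⟨ ℕₚ.*-assoc k (∣ t ∣) 4 ⟩
    k ℕ.* ((∣ t ∣) ℕ.* 4)    ≡⟨ ℕₚ.*-comm k ((∣ t ∣) ℕ.* 4) ⟩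
    (∣ t ∣) ℕ.* 4 ℕ.* k      ∎)

module Characterisation (N : ℕ) (N%4≡3 : N % 4 ≡ 3) (α : Zω) (α≢0 : α ≢ 0ω) where

  open Lattice N
  open Mod4 N N%4≡3

  Conditions : Set
  Conditions = Primitive (α · θ)
             × (∃ λ k → Odd k × k ∣ suc N × IntegralPrimitiveQuot N (α · (fromℤ (+ N) ⊖ θ)) (+ 2 * + k))
             × (∃ λ k → Odd k × k ∣ suc N × IntegralPrimitiveQuot N (α · (fromℤ (+ N) ⊕ θ)) (+ 2 * + k))

  private
    N-θ : α · (fromℤ (+ N) ⊖ θ) ≡ ⊝ ((+ 2) ∙ (α · ω · θ))
    N-θ = trans (cong (λ n → α · (fromℤ n ⊖ θ)) N≡4c-1) ([4c-1]-θ≡-2ωθ α)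

    N+θ : α · (fromℤ (+ N) ⊕ θ) ≡ ⊝ ((+ 2) ∙ (α · ω-1 · θ))
    N+θ = trans (cong (λ n → α · (fromℤ n ⊕ θ)) N≡4c-1) ([4c-1]+θ≡-2[ω-1]θ α)

    necessary : ∀ v v′ {x} → v ≢ 0ω → Relevant v → α · v · θ · v′ ≡ c ∙ (α · θ) →
                x ≡ ⊝ ((+ 2) ∙ (α · v · θ)) → Clean N α →
                ∃ λ k → Odd k × k ∣ suc N × IntegralPrimitiveQuot N x (+ 2 * + k)
    necessary v v′ v≢0 relevant αvθv′≡ x≡ clean =
      let (k , odd , (t , c≡kt) , edge-content) =
            clean⇒divisor-content 1≤c α v v′ α≢0 v≢0 relevant αvθv′≡ clean
      in k , odd , divisor-of-c k t c≡kt , Equivalence.from (quotient⇔edge-content α v (+ k) _ x≡) edge-content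

    sufficient : ∀ v {x} → x ≡ ⊝ ((+ 2) ∙ (α · v · θ)) →
                 (∃ λ k → Odd k × k ∣ suc N × IntegralPrimitiveQuot N x (+ 2 * + k)) → OddContent 1≤c α v
    sufficient v x≡ (k , odd , k∣sucN , quot) =
      k , odd , odd-divisor-bound k odd k∣sucN , Equivalence.to (quotient⇔edge-content α v (+ k) _ x≡) quot

  clean⇒conditions : Clean N α → Conditions
  clean⇒conditions clean =
    clean⇒primitive 1≤c α α≢0 clean ,
    necessary ω (1ω ⊖ ω) (λ ()) (relevant-ω 1≤c) (ω·[1-ω]≡c α) N-θ clean ,
    necessary ω-1 (⊝ ω) (λ ()) (relevant-ω-1 1≤c) ([ω-1]·-ω≡c α) N+θ clean

  conditions⇒clean : Conditions → Clean N α
  conditions⇒clean (αθ-primitive , quot-ω , quot-ω-1) =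
    clean-if 1≤c α α≢0 αθ-primitive (sufficient ω N-θ quot-ω) (sufficient ω-1 N+θ quot-ω-1)

theorem6 : (N : ℕ) → N % 4 ≡ 3 → (α : Zω) → α ≢ (+ 0 , + 0) →
    Clean N α ⇔
      ( Primitive (mul N α θ)
      × (∃ λ k → Odd k × k ∣ suc N × IntegralPrimitiveQuot N (mul N α (fromℤ (+ N) ⊖ θ)) (+ 2 * + k))
      × (∃ λ k → Odd k × k ∣ suc N × IntegralPrimitiveQuot N (mul N α (fromℤ (+ N) ⊕ θ)) (+ 2 * + k)) )
theorem6 N N%4≡3 α α≢0 = mk⇔ clean⇒conditions conditions⇒clean
  where open Characterisation N N%4≡3 α α≢0
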